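{- For integers $t \ge 0$, let $N(t)$ be the number of tilings of the $5 \times 3t$ rectangle by right trominoes, with $N(0)=1$. Then \[ \sum_{t \ge 0} N(t)\, z^t = \frac{1 - 2 z - 31 z^2 - 40 z^3 - 20 z^4}{1 - 2 z - 103 z^2 - 280 z^3 - 380 z^4}. \] Consequently $N(t)$ grows like $\lambda^t$, where $\lambda = 12.3636672\ldots$ is the largest positive root of $\lambda^4 - 2\lambda^3 - 103\lambda^2 - 280\lambda - 380 = 0$.
   Context: A right tromino is the polyomino of three unit squares obtained by deleting one cell from a $2 \times 2$ square. A tiling of a region by a polyomino is a partition of its unit cells into copies of the polyomino, where copies may be translated, rotated and reflected. A $5 \times n$ rectangle has 5 rows and $n$ columns. -}

module Defs where

open import Data.Nat using (ℕ; zero; suc; _+_; _∸_; _≡ᵇ_)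
open import Data.Nat.Properties using () renaming (_≟_ to _≟ℕ_)
open import Data.Bool using (Bool; true; false; _∧_; _∨_; not; T)
open import Data.Fin using (Fin; toℕ)
open import Data.Fin.Properties using (all?)
open import Data.List using (List; []; _∷_; length; filter; upTo; allFin; concatMap; map; zip; foldr)
open import Data.Vec using (Vec; []; _∷_; toList)
open import Data.Product using (_×_; _,_; proj₁; proj₂)
open import Data.Integer using (ℤ; +_; -[1+_]; _*_) renaming (_+_ to _+ℤ_)
open import Relation.Binary.PropositionalEquality using (_≡_)
open import Relation.Nullary using (Dec)
open import Relation.Nullary.Decidable using (T?)

-- A placement of a right tromino inside the 5 × n rectangle (rows 0..4,
-- columns 0..n-1): the tromino is the 2×2 block with top-left cell
-- (r , c) minus one of its four cells, selected by k : Fin 4 (offsets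
-- 0 ↦ (0,0), 1 ↦ (0,1), 2 ↦ (1,0), 3 ↦ (1,1)).  Every copy (rotated /
-- reflected / translated) of the right tromino lying inside the rectangle
-- is exactly one such placement.
Placement : Set
Placement = ℕ × ℕ × Fin 4

rowOff : Fin 4 → ℕ
rowOff k = Data.Nat._/_ (toℕ k) 2
  where open import Data.Nat using (_/_)

colOff : Fin 4 → ℕ
colOff k = Data.Nat._%_ (toℕ k) 2
  where open import Data.Nat using (_%_)

placements : ℕ → List Placement
placements n =
  concatMap (λ r → concatMap (λ c → map (λ k → r , c , k) (allFin 4))
                             (upTo (n ∸ 1)))
            (upTo 4)

covers : Placement → ℕ → ℕ → Bool
covers (r , c , k) i j =
  ((i ≡ᵇ r) ∨ (i ≡ᵇ suc r)) ∧ ((j ≡ᵇ c) ∨ (j ≡ᵇ suc c))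
  ∧ not ((i ≡ᵇ r + rowOff k) ∧ (j ≡ᵇ c + colOff k))

Choice : ℕ → Set
Choice n = Vec Bool (length (placements n))

chosen : (n : ℕ) → Choice n → List Placement
chosen n S = map proj₁ (filter (λ x → T? (proj₂ x)) (zip (placements n) (toList S)))

coverCount : (n : ℕ) → Choice n → Fin 5 → Fin n → ℕ
coverCount n S i j = length (filter (λ p → T? (covers p (toℕ i) (toℕ j))) (chosen n S))

IsTiling : (n : ℕ) → Choice n → Set
IsTiling n S = (i : Fin 5) (j : Fin n) → coverCount n S i j ≡ 1

isTiling? : (n : ℕ) → (S : Choice n) → Dec (IsTiling n S)
isTiling? n S = all? (λ i → all? (λ j → coverCount n S i j ≟ℕ 1))

allVecs : (m : ℕ) → List (Vec Bool m)
allVecs zero = [] ∷ []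
allVecs (suc m) = concatMap (λ v → (true ∷ v) ∷ (false ∷ v) ∷ []) (allVecs m)

tilings : ℕ → ℕ
tilings n = length (filter (isTiling? n) (allVecs (length (placements n))))

N : ℕ → ℕ
N t = tilings (3 Data.Nat.* t)

Series : Set
Series = ℕ → ℤ

_⋆_ : Series → Series → Series
(f ⋆ g) n = foldr _+ℤ_ (+ 0) (map (λ k → f k * g (n ∸ k)) (upTo (suc n)))

-- polynomial given by its coefficient list (constant term first)
poly : List ℤ → Series
poly [] n = + 0
poly (a ∷ as) zero = a
poly (a ∷ as) (suc n) = poly as n

numerator : Series
numerator = poly (+ 1 ∷ -[1+ 1 ] ∷ -[1+ 30 ] ∷ -[1+ 39 ] ∷ -[1+ 19 ] ∷ [])

denominator : Series
denominator = poly (+ 1 ∷ -[1+ 1 ] ∷ -[1+ 102 ] ∷ -[1+ 279 ] ∷ -[1+ 379 ] ∷ [])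

NSeries : Series
NSeries t = + N t

module Submission where

-- Process the rectangle from its last column to its first, placing at each step the trominoes
-- whose left column is the current one.  What is left to cover of the current column is a
-- profile (a subset of its 5 rows), so the number of tilings of m columns followed by a
-- partial column of profile a is obtained by iterating a linear transfer operator on functions
-- of the 32 profiles, starting from the indicator of the empty profile.  Computing the first
-- fifteen iterates shows that the 14th is 2·(11th) + 103·(8th) + 280·(5th) + 380·(2nd); by
-- linearity the same relation links all later iterates.  As N(t+1) is the value of iterate
-- 3t + 2 at the full profile, N(t+5) = 2 N(t+4) + 103 N(t+3) + 280 N(t+2) + 380 N(t+1),
-- i.e. the denominator times Σ N(t) zᵗ is a polynomial of degree 4, and its five coefficients
-- are those of the numerator by direct computation.

open import Defs
open import Data.Bool using (Bool; true; false; T; not; _∧_; _∨_; if_then_else_)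
open import Data.Bool.Properties using (∧-zeroʳ)
open import Data.Empty using (⊥-elim)
open import Data.Fin as Fin using (Fin; toℕ)
open import Data.Fin.Properties using (all?; toℕ-fromℕ<; ¬∀⟶∃¬; toℕ≤pred[n])
open import Data.Integer.Properties using (pos-+; pos-*)
open import Data.Integer.Tactic.RingSolver renaming (solve-∀ to ℤ-solve-∀)
open import Data.List using (List; []; _∷_; _++_; length; map; filter; zip; concatMap; foldr; upTo; downFrom; allFin)
open import Data.List.Properties using (filter-≐; filter-none; ++-assoc; reverse-upTo; map-applyUpTo; map-cong)
open import Data.List.Relation.Binary.Permutation.Propositional as ↭ using (_↭_; prep; swap; module PermutationReasoning)
open import Data.List.Relation.Binary.Permutation.Propositional.Properties using (++⁺ˡ; shifts; ↭-reverse)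
open import Data.List.Relation.Unary.All as All using (All; []; _∷_)
import Data.List.Relation.Unary.All.Properties as All
open import Data.Nat using (ℕ; zero; suc; _+_; _*_; _∸_; _≤_; _<_; _≤?_; _≟_; _≡ᵇ_; z≤n; s≤s)
open import Data.Nat.Properties
  using (0∸n≡0; +-suc; +-comm; +-identityʳ; ∸-+-assoc; m∸n≤m; ≤-refl; ≤-trans; <⇒≤; n≤1+n; m≤m+n;
         n≢0⇒n>0; *-zeroʳ; *-distribˡ-+; ≤-<-connex; m≤n⇒∃[o]m+o≡n)
open import Data.Nat.Tactic.RingSolver using (solve-∀)
open import Data.Product using (_×_; _,_; proj₁; proj₂)
open import Data.Sum using ([_,_]′)
open import Data.Unit using (tt)
open import Data.Vec using (Vec; []; _∷_; toList; replicate)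
open import Function using (id; _∘_; _⇔_; mk⇔; Equivalence)
open import Function.Construct.Composition using (_⇔-∘_)
open import Relation.Binary.Core using (_Preserves_⟶_)
open import Relation.Binary.PropositionalEquality
  using (_≡_; _≗_; refl; sym; trans; cong; cong₂; subst; module ≡-Reasoning)
open import Relation.Nullary using (Dec; yes; no; does; ¬_)
open import Relation.Nullary.Decidable using (T?; _→-dec_; _×-dec_; does-⇔; dec-false; map′; toWitness)
open import Relation.Unary using (Decidable)

-- Exact covers of a demand

Demand : Set
Demand = ℕ → ℕ → ℕ

bit : Bool → ℕ
bit true  = 1
bit false = 0

when : Bool → ℕ → ℕ
when b n = if b then n else 0

when-zero : ∀ b → when b 0 ≡ 0
when-zero true  = refl
when-zero false = refl

when-affine : ∀ b c x y → when b (c * x + y) ≡ c * when b x + when b y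
when-affine true  c x y = refl
when-affine false c x y = sym (cong (_+ 0) (*-zeroʳ c))

when-exchange : ∀ x y u v A B C E → x ∧ u ≡ y ∧ v →
  (A + when y B) + when x (C + when u E) ≡ (A + when x C) + when y (B + when v E)
when-exchange true  true  u v     A B C E refl = exchange A B C (when u E)
  where
  exchange : ∀ a b c d → (a + b) + (c + d) ≡ (a + c) + (b + d)
  exchange = solve-∀
when-exchange true  false false v A B C E _ =
  trans (cong₂ _+_ (+-identityʳ A) (+-identityʳ C)) (sym (+-identityʳ (A + C)))
when-exchange false true  u false A B C E _ =
  trans (+-identityʳ (A + B)) (sym (cong₂ _+_ (+-identityʳ A) (+-identityʳ B)))
when-exchange false false u v     A B C E _ = refl

bit+≡⇔ : ∀ b {m n d} → n ≡ bit b + m → (n ≡ d) ⇔ ((T b → 1 ≤ d) × m ≡ d ∸ bit b)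
bit+≡⇔ false refl = mk⇔ (λ n≡d → (λ ()) , n≡d) proj₂
bit+≡⇔ true  refl = mk⇔ (λ { refl → (λ _ → s≤s z≤n) , refl }) from
  where
  from : ∀ {m d} → (T true → 1 ≤ d) × m ≡ d ∸ 1 → suc m ≡ d
  from {d = suc d} (_ , refl) = refl
  from {d = zero}  (1≤0 , _) with () ← 1≤0 _

length-filter-[x] : ∀ {A : Set} {P : A → Set} (P? : Decidable P) x →
                    length (filter P? (x ∷ [])) ≡ when (does (P? x)) 1
length-filter-[x] P? x with does (P? x)
... | true  = refl
... | false = refl

length-filter-bothHeads : ∀ {n} {P : Vec Bool (suc n) → Set} (P? : Decidable P) (vs : List (Vec Bool n)) →
  length (filter P? (concatMap (λ v → (true ∷ v) ∷ (false ∷ v) ∷ []) vs))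
    ≡ length (filter (λ v → P? (false ∷ v)) vs) + length (filter (λ v → P? (true ∷ v)) vs)
length-filter-bothHeads P? []       = refl
length-filter-bothHeads P? (v ∷ vs) with does (P? (true ∷ v))
... | true  with does (P? (false ∷ v))
...   | true  = cong suc (trans (cong suc (length-filter-bothHeads P? vs)) (sym (+-suc _ _)))
...   | false = trans (cong suc (length-filter-bothHeads P? vs)) (sym (+-suc _ _))
length-filter-bothHeads P? (v ∷ vs) | false with does (P? (false ∷ v))
...   | true  = cong suc (length-filter-bothHeads P? vs)
...   | false = length-filter-bothHeads P? vs

_without_ : Demand → Placement → Demand
(D without p) i j = D i j ∸ bit (covers p i j)

module Cover (h w : ℕ) where

  record _≈_ (D E : Demand) : Set where
    constructor agree
    field agreeAt : (i : Fin h) (j : Fin w) → D (toℕ i) (toℕ j) ≡ E (toℕ i) (toℕ j)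
  open _≈_ public

  ≈-sym : ∀ {D E} → D ≈ E → E ≈ D
  ≈-sym D≈E = agree λ i j → sym (agreeAt D≈E i j)

  Vanishes : Demand → Set
  Vanishes D = (i : Fin h) (j : Fin w) → D (toℕ i) (toℕ j) ≡ 0

  vanishes? : (D : Demand) → Dec (Vanishes D)
  vanishes? D = all? λ i → all? λ j → D (toℕ i) (toℕ j) ≟ 0

  Fits : Placement → Demand → Set
  Fits p D = (i : Fin h) (j : Fin w) → T (covers p (toℕ i) (toℕ j)) → 1 ≤ D (toℕ i) (toℕ j)

  fits? : (p : Placement) (D : Demand) → Dec (Fits p D)
  fits? p D = all? λ i → all? λ j → T? (covers p (toℕ i) (toℕ j)) →-dec 1 ≤? D (toℕ i) (toℕ j)

  -- The sum of K (D minus the cells of Q) over the sublists Q of ps whose trominoes fit into D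
  -- one after the other.
  sumPackings : List Placement → (Demand → ℕ) → Demand → ℕ
  sumPackings []       K D = K D
  sumPackings (p ∷ ps) K D = sumPackings ps K D + when (does (fits? p D)) (sumPackings ps K (D without p))

  fulfilled : Demand → ℕ
  fulfilled D = when (does (vanishes? D)) 1

  exactCovers : List Placement → Demand → ℕ
  exactCovers ps = sumPackings ps fulfilled

  selected : (ps : List Placement) → Vec Bool (length ps) → List Placement
  selected ps S = map proj₁ (filter (λ x → T? (proj₂ x)) (zip ps (toList S)))

  multiplicity : (ps : List Placement) → Vec Bool (length ps) → ℕ → ℕ → ℕ
  multiplicity ps S i j = length (filter (λ p → T? (covers p i j)) (selected ps S))

  CoversExactly : (ps : List Placement) → Demand → Vec Bool (length ps) → Set
  CoversExactly ps D S = (i : Fin h) (j : Fin w) → multiplicity ps S (toℕ i) (toℕ j) ≡ D (toℕ i) (toℕ j)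

  coversExactly? : ∀ ps D → Decidable (CoversExactly ps D)
  coversExactly? ps D S = all? λ i → all? λ j → multiplicity ps S (toℕ i) (toℕ j) ≟ D (toℕ i) (toℕ j)

  multiplicity-∷-true : ∀ p ps S i j →
    multiplicity (p ∷ ps) (true ∷ S) i j ≡ bit (covers p i j) + multiplicity ps S i j
  multiplicity-∷-true p ps S i j with covers p i j
  ... | true  = refl
  ... | false = refl

  coversExactly-∷-true : ∀ p ps D S →
    CoversExactly (p ∷ ps) D (true ∷ S) ⇔ (Fits p D × CoversExactly ps (D without p) S)
  coversExactly-∷-true p ps D S = mk⇔
    (λ c → (λ i j → proj₁ (to (cell i j) (c i j))) , (λ i j → proj₂ (to (cell i j) (c i j))))
    (λ (f , c) i j → from (cell i j) (f i j , c i j))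
    where
    open Equivalence
    cell : ∀ (i : Fin h) (j : Fin w) → let i′ = toℕ i; j′ = toℕ j in
           (multiplicity (p ∷ ps) (true ∷ S) i′ j′ ≡ D i′ j′)
             ⇔ ((T (covers p i′ j′) → 1 ≤ D i′ j′) × multiplicity ps S i′ j′ ≡ (D without p) i′ j′)
    cell i j = bit+≡⇔ (covers p (toℕ i) (toℕ j)) (multiplicity-∷-true p ps S (toℕ i) (toℕ j))

  count-coversExactly : ∀ ps D (P? : Decidable (CoversExactly ps D)) →
                        length (filter P? (allVecs (length ps))) ≡ exactCovers ps D
  count-coversExactly [] D P? =
    trans (length-filter-[x] P? [])
          (cong (λ b → when b 1) (does-⇔ (mk⇔ (λ c i j → sym (c i j)) (λ D≡0 i j → sym (D≡0 i j)))
                                         (P? []) (vanishes? D)))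
  count-coversExactly (p ∷ ps) D P? =
    trans (length-filter-bothHeads P? Ss)
          (cong₂ _+_ (count-coversExactly ps D (λ S → P? (false ∷ S))) (count-with-p (fits? p D)))
    where
    open Equivalence
    Ss = allVecs (length ps)
    count-with-p : (p-fits? : Dec (Fits p D)) →
      length (filter (λ S → P? (true ∷ S)) Ss) ≡ when (does p-fits?) (exactCovers ps (D without p))
    count-with-p (yes p-fits) =
      trans (cong length (filter-≐ _ (coversExactly? ps (D without p))
                            ((λ {S} c → proj₂ (to (coversExactly-∷-true p ps D S) c)) ,
                             (λ {S} c → from (coversExactly-∷-true p ps D S) (p-fits , c))) Ss))
            (count-coversExactly ps (D without p) (coversExactly? ps (D without p)))
    count-with-p (no p-misfits) =
      cong length (filter-none _ (All.universal (λ S c → p-misfits (proj₁ (to (coversExactly-∷-true p ps D S) c))) Ss))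

  Fits-resp-≈ : ∀ {p D E} → D ≈ E → Fits p D → Fits p E
  Fits-resp-≈ D≈E fits i j c = subst (1 ≤_) (agreeAt D≈E i j) (fits i j c)

  Vanishes-resp-≈ : ∀ {D E} → D ≈ E → Vanishes D → Vanishes E
  Vanishes-resp-≈ D≈E D≡0 i j = trans (sym (agreeAt D≈E i j)) (D≡0 i j)

  without-resp-≈ : ∀ p {D E} → D ≈ E → (D without p) ≈ (E without p)
  without-resp-≈ p D≈E = agree λ i j → cong (_∸ bit (covers p (toℕ i) (toℕ j))) (agreeAt D≈E i j)

  sumPackings-cong : ∀ ps {K} → K Preserves _≈_ ⟶ _≡_ → (sumPackings ps K) Preserves _≈_ ⟶ _≡_
  sumPackings-cong []       K-cong D≈E = K-cong D≈E
  sumPackings-cong (p ∷ ps) K-cong {D} {E} D≈E =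
    cong₂ _+_ (sumPackings-cong ps K-cong D≈E)
              (cong₂ when (does-⇔ (mk⇔ (Fits-resp-≈ {p} D≈E) (Fits-resp-≈ {p} (≈-sym D≈E)))
                                  (fits? p D) (fits? p E))
                          (sumPackings-cong ps K-cong (without-resp-≈ p D≈E)))

  fulfilled-cong : fulfilled Preserves _≈_ ⟶ _≡_
  fulfilled-cong {D} {E} D≈E =
    cong (λ b → when b 1)
         (does-⇔ (mk⇔ (Vanishes-resp-≈ D≈E) (Vanishes-resp-≈ (≈-sym D≈E))) (vanishes? D) (vanishes? E))

  exactCovers-cong : ∀ ps → (exactCovers ps) Preserves _≈_ ⟶ _≡_
  exactCovers-cong ps = sumPackings-cong ps fulfilled-cong

  fits-swap : ∀ {p q D} → Fits p D × Fits q (D without p) → Fits q D × Fits p (D without q)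
  fits-swap {p} {q} (fits-p , fits-q) =
    (λ i j → proj₁ (cell (covers p (toℕ i) (toℕ j)) (covers q (toℕ i) (toℕ j)) (fits-p i j) (fits-q i j))) ,
    (λ i j → proj₂ (cell (covers p (toℕ i) (toℕ j)) (covers q (toℕ i) (toℕ j)) (fits-p i j) (fits-q i j)))
    where
    cell : ∀ b c {d} → (T b → 1 ≤ d) → (T c → 1 ≤ d ∸ bit b) → (T c → 1 ≤ d) × (T b → 1 ≤ d ∸ bit c)
    cell true  true  {d} _  fc = (λ _ → ≤-trans (fc _) (m∸n≤m d 1)) , fc
    cell true  false     fb _  = (λ ()) , fb
    cell false true      _  fc = fc , (λ ())
    cell false false     _  _  = (λ ()) , (λ ())

  without-comm : ∀ p q D → ((D without p) without q) ≈ ((D without q) without p)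
  without-comm p q D =
    agree λ i j → cell (D (toℕ i) (toℕ j)) (bit (covers p (toℕ i) (toℕ j))) (bit (covers q (toℕ i) (toℕ j)))
    where
    cell : ∀ d a b → d ∸ a ∸ b ≡ d ∸ b ∸ a
    cell d a b = begin
      d ∸ a ∸ b   ≡⟨ ∸-+-assoc d a b ⟩
      d ∸ (a + b) ≡⟨ cong (d ∸_) (+-comm a b) ⟩
      d ∸ (b + a) ≡⟨ ∸-+-assoc d b a ⟨
      d ∸ b ∸ a   ∎
      where open ≡-Reasoning

  sumPackings-swap : ∀ p q ps {K} → K Preserves _≈_ ⟶ _≡_ → ∀ D →
                     sumPackings (p ∷ q ∷ ps) K D ≡ sumPackings (q ∷ p ∷ ps) K D
  sumPackings-swap p q ps {K} K-cong D =
    trans (cong (λ n → S D + when (does q|D) (S (D without q))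
                       + when (does p|D) (S (D without p) + when (does q|D-p) n))
                (sumPackings-cong ps K-cong (without-comm p q D)))
          (when-exchange (does p|D) (does q|D) (does q|D-p) (does p|D-q) _ _ _ _
                         (does-⇔ (mk⇔ (fits-swap {p} {q} {D}) (fits-swap {q} {p} {D}))
                                 (p|D ×-dec q|D-p) (q|D ×-dec p|D-q)))
    where
    S = sumPackings ps K
    p|D   = fits? p D
    q|D   = fits? q D
    q|D-p = fits? q (D without p)
    p|D-q = fits? p (D without q)

  sumPackings-prep : ∀ p xs ys {K} → (∀ D → sumPackings xs K D ≡ sumPackings ys K D) →
                     ∀ D → sumPackings (p ∷ xs) K D ≡ sumPackings (p ∷ ys) K D
  sumPackings-prep p xs ys eq D = cong₂ _+_ (eq D) (cong (when _) (eq (D without p)))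

  sumPackings-↭ : ∀ {xs ys K} → K Preserves _≈_ ⟶ _≡_ → xs ↭ ys →
                  ∀ D → sumPackings xs K D ≡ sumPackings ys K D
  sumPackings-↭ K-cong ↭.refl                    D = refl
  sumPackings-↭ K-cong (prep {xs} {ys} p xs↭ys)   = sumPackings-prep p xs ys (sumPackings-↭ K-cong xs↭ys)
  sumPackings-↭ K-cong (swap {xs} {ys} p q xs↭ys) D =
    trans (sumPackings-swap p q xs K-cong D)
          (sumPackings-prep q (p ∷ xs) (p ∷ ys) (sumPackings-prep p xs ys (sumPackings-↭ K-cong xs↭ys)) D)
  sumPackings-↭ K-cong (↭.trans xs↭ys ys↭zs)     D =
    trans (sumPackings-↭ K-cong xs↭ys D) (sumPackings-↭ K-cong ys↭zs D)

  exactCovers-↭ : ∀ {xs ys} → xs ↭ ys → ∀ D → exactCovers xs D ≡ exactCovers ys D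
  exactCovers-↭ = sumPackings-↭ fulfilled-cong

  sumPackings-++ : ∀ xs ys K D → sumPackings (xs ++ ys) K D ≡ sumPackings xs (sumPackings ys K) D
  sumPackings-++ []       ys K D = refl
  sumPackings-++ (p ∷ xs) ys K D =
    cong₂ _+_ (sumPackings-++ xs ys K D) (cong (when _) (sumPackings-++ xs ys K (D without p)))

  exactCovers-uncovered : ∀ ps D (i : Fin h) (j : Fin w) → 1 ≤ D (toℕ i) (toℕ j) →
                          All (λ p → covers p (toℕ i) (toℕ j) ≡ false) ps → exactCovers ps D ≡ 0
  exactCovers-uncovered [] D i j 1≤D [] =
    cong (λ b → when b 1) (dec-false (vanishes? D) λ D≡0 → 1≰0 (subst (1 ≤_) (D≡0 i j) 1≤D))
    where
    1≰0 : ¬ 1 ≤ 0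
    1≰0 ()
  exactCovers-uncovered (p ∷ ps) D i j 1≤D (p-misses ∷ ps-miss) =
    cong₂ _+_ (exactCovers-uncovered ps D i j 1≤D ps-miss)
              (trans (cong (when _) (exactCovers-uncovered ps (D without p) i j 1≤D-p ps-miss)) (when-zero _))
    where
    1≤D-p : 1 ≤ (D without p) (toℕ i) (toℕ j)
    1≤D-p = subst (λ b → 1 ≤ D (toℕ i) (toℕ j) ∸ bit b) (sym p-misses) 1≤D

-- Reordering the placements column by column

concatMap⁺ : ∀ {A B : Set} (f : A → List B) {xs ys} → xs ↭ ys → concatMap f xs ↭ concatMap f ys
concatMap⁺ f ↭.refl                = ↭.refl
concatMap⁺ f (prep x xs↭ys)        = ++⁺ˡ (f x) (concatMap⁺ f xs↭ys)
concatMap⁺ f (swap x y xs↭ys)      = ↭.trans (shifts (f x) (f y)) (++⁺ˡ (f y) (++⁺ˡ (f x) (concatMap⁺ f xs↭ys)))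
concatMap⁺ f (↭.trans xs↭ys ys↭zs) = ↭.trans (concatMap⁺ f xs↭ys) (concatMap⁺ f ys↭zs)

concatMap-++-distrib : ∀ {A B : Set} (f g : A → List B) xs →
                       concatMap (λ x → f x ++ g x) xs ↭ concatMap f xs ++ concatMap g xs
concatMap-++-distrib f g []       = ↭.refl
concatMap-++-distrib f g (x ∷ xs) = begin
  (f x ++ g x) ++ concatMap (λ x → f x ++ g x) xs  ≡⟨ ++-assoc (f x) (g x) _ ⟩
  f x ++ g x ++ concatMap (λ x → f x ++ g x) xs    ↭⟨ ++⁺ˡ (f x) (++⁺ˡ (g x) (concatMap-++-distrib f g xs)) ⟩
  f x ++ g x ++ concatMap f xs ++ concatMap g xs   ↭⟨ ++⁺ˡ (f x) (shifts (g x) (concatMap f xs)) ⟩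
  f x ++ concatMap f xs ++ g x ++ concatMap g xs   ≡⟨ ++-assoc (f x) _ _ ⟨
  (f x ++ concatMap f xs) ++ g x ++ concatMap g xs ∎
  where open PermutationReasoning

concatMap-comm : ∀ {A B C : Set} (f : A → B → List C) xs ys →
                 concatMap (λ x → concatMap (f x) ys) xs ↭ concatMap (λ y → concatMap (λ x → f x y) xs) ys
concatMap-comm f []       ys = ↭.↭-reflexive (sym (concatMap-[] ys))
  where
  concatMap-[] : ∀ {A C : Set} (ys : List A) → concatMap (λ _ → []) ys ≡ ([] {A = C})
  concatMap-[] []       = refl
  concatMap-[] (y ∷ ys) = concatMap-[] ys
concatMap-comm f (x ∷ xs) ys =
  ↭.trans (++⁺ˡ (concatMap (f x) ys) (concatMap-comm f xs ys))
          (↭.↭-sym (concatMap-++-distrib (f x) (λ y → concatMap (λ x → f x y) xs) ys))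

LocalPlacement : Set
LocalPlacement = ℕ × Fin 4

localPlacements : ℕ → List LocalPlacement
localPlacements h = concatMap (λ r → map (r ,_) (allFin 4)) (upTo (h ∸ 1))

atColumn : ℕ → LocalPlacement → Placement
atColumn c (r , k) = r , c , k

byColumn : ℕ → ℕ → List Placement
byColumn h m = concatMap (λ c → map (atColumn c) (localPlacements h)) (downFrom m)

placements-↭-byColumn : ∀ m → placements (suc m) ↭ byColumn 5 m
placements-↭-byColumn m = begin
  placements (suc m)
    ↭⟨ concatMap-comm (λ r c → map (λ k → r , c , k) (allFin 4)) (upTo 4) (upTo m) ⟩
  concatMap (λ c → map (atColumn c) (localPlacements 5)) (upTo m)
    ↭⟨ concatMap⁺ (λ c → map (atColumn c) (localPlacements 5)) upTo↭downFrom ⟩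
  byColumn 5 m ∎
  where
  open PermutationReasoning
  upTo↭downFrom : upTo m ↭ downFrom m
  upTo↭downFrom = ↭.↭-trans (↭.↭-sym (↭-reverse (upTo m))) (↭.↭-reflexive (reverse-upTo m))

tilings≡exactCovers : ∀ m → tilings (suc m) ≡ Cover.exactCovers 5 (suc m) (byColumn 5 m) (λ _ _ → 1)
tilings≡exactCovers m =
  trans (Cover.count-coversExactly 5 (suc m) (placements (suc m)) (λ _ _ → 1) (isTiling? (suc m)))
        (Cover.exactCovers-↭ 5 (suc m) (placements-↭-byColumn m) (λ _ _ → 1))

-- Profiles and the transfer operator

Profile : ℕ → Set
Profile h = Vec Bool h

bitAt : ∀ {h} → Profile h → ℕ → ℕ
bitAt []       _       = 0
bitAt (x ∷ xs) zero    = bit x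
bitAt (x ∷ xs) (suc i) = bitAt xs i

full blank : ∀ h → Profile h
full  h = replicate h true
blank h = replicate h false

Blank : ∀ {h} → Profile h → Set
Blank {h} a = (i : Fin h) → bitAt a (toℕ i) ≡ 0

blank? : ∀ {h} (a : Profile h) → Dec (Blank a)
blank? a = all? λ i → bitAt a (toℕ i) ≟ 0

clear : ∀ {h} → Profile h → (ℕ → Bool) → Profile h
clear []       g = []
clear (x ∷ xs) g = (x ∧ not (g 0)) ∷ clear xs (g ∘ suc)

bitAt-full : ∀ {h} (i : Fin h) → bitAt (full h) (toℕ i) ≡ 1
bitAt-full Fin.zero    = refl
bitAt-full (Fin.suc i) = bitAt-full i

blank-Blank : ∀ {h} → Blank (blank h)
blank-Blank Fin.zero    = refl
blank-Blank (Fin.suc i) = blank-Blank i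

bitAt-clear : ∀ {h} (a : Profile h) g i → bitAt (clear a g) i ≡ bitAt a i ∸ bit (g i)
bitAt-clear []      g i       = sym (0∸n≡0 (bit (g i)))
bitAt-clear (x ∷ a) g (suc i) = bitAt-clear a (g ∘ suc) i
bitAt-clear (x ∷ a) g zero    with x | g 0
... | true  | true  = refl
... | true  | false = refl
... | false | true  = refl
... | false | false = refl

-- What remains to be covered once the columns after m + 1 are tiled: columns before m in full,
-- profile a in column m and profile b in column m + 1.
frontier : ∀ {h} → ℕ → Profile h → Profile h → Demand
frontier zero    a b i zero          = bitAt a i
frontier zero    a b i (suc zero)    = bitAt b i
frontier zero    a b i (suc (suc j)) = 0
frontier (suc m) a b i zero          = 1
frontier (suc m) a b i (suc j)       = frontier m a b i j

frontier-right : ∀ {h} m (a b : Profile h) i → frontier m a b i (suc m) ≡ bitAt b i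
frontier-right zero    a b i = refl
frontier-right (suc m) a b i = frontier-right m a b i

frontier-full : ∀ {h} m (b : Profile h) (i : Fin h) j → j ≤ m → frontier m (full h) b (toℕ i) j ≡ 1
frontier-full zero    b i zero    _         = bitAt-full i
frontier-full (suc m) b i zero    _         = refl
frontier-full (suc m) b i (suc j) (s≤s j≤m) = frontier-full m b i j j≤m

frontier-shift : ∀ {h} m (a b : Profile h) → Blank b →
                 ∀ (i : Fin h) j → frontier (suc m) a b (toℕ i) j ≡ frontier m (full h) a (toℕ i) j
frontier-shift zero    a b b-blank i zero                = sym (bitAt-full i)
frontier-shift zero    a b b-blank i (suc zero)          = refl
frontier-shift zero    a b b-blank i (suc (suc zero))    = b-blank i
frontier-shift zero    a b b-blank i (suc (suc (suc j))) = refl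
frontier-shift (suc m) a b b-blank i zero                = refl
frontier-shift (suc m) a b b-blank i (suc j)             = frontier-shift m a b b-blank i j

covers-leftOf : ∀ r c k i → covers (r , suc c , k) i 0 ≡ false
covers-leftOf r c k i = ∧-zeroʳ ((i ≡ᵇ r) ∨ (i ≡ᵇ suc r))

covers-beyond : ∀ r c k i j → suc (suc c) ≤ j → covers (r , c , k) i j ≡ false
covers-beyond r zero    k i (suc (suc j)) _           = ∧-zeroʳ ((i ≡ᵇ r) ∨ (i ≡ᵇ suc r))
covers-beyond r zero    k i (suc zero)    (s≤s ())
covers-beyond r (suc c) k i (suc j)       (s≤s 2+c≤j) = covers-beyond r c k i j 2+c≤j

LocalFits : ∀ {h} → LocalPlacement → Profile h → Profile h → Set
LocalFits {h} q a b = (i : Fin h) → (T (covers (atColumn 0 q) (toℕ i) 0) → 1 ≤ bitAt a (toℕ i))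
                                  × (T (covers (atColumn 0 q) (toℕ i) 1) → 1 ≤ bitAt b (toℕ i))

localFits? : ∀ {h} q (a b : Profile h) → Dec (LocalFits q a b)
localFits? q a b = all? λ i → (T? (covers (atColumn 0 q) (toℕ i) 0) →-dec 1 ≤? bitAt a (toℕ i))
                        ×-dec (T? (covers (atColumn 0 q) (toℕ i) 1) →-dec 1 ≤? bitAt b (toℕ i))

leftAfter rightAfter : ∀ {h} → LocalPlacement → Profile h → Profile h
leftAfter  q a = clear a (λ i → covers (atColumn 0 q) i 0)
rightAfter q b = clear b (λ i → covers (atColumn 0 q) i 1)

sumLocalPackings : ∀ {h} → List LocalPlacement → (Profile h → Profile h → ℕ) → Profile h → Profile h → ℕ
sumLocalPackings []       K a b = K a b
sumLocalPackings (q ∷ qs) K a b =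
  sumLocalPackings qs K a b + when (does (localFits? q a b)) (sumLocalPackings qs K (leftAfter q a) (rightAfter q b))

whenBlank : ∀ {h} → (Profile h → ℕ) → Profile h → Profile h → ℕ
whenBlank v a b = when (does (blank? b)) (v a)

-- The trominoes with left column m see column m in full and column m + 1 as profile a; column
-- m + 1 must end up covered, as no later tromino reaches it, and what is left of column m is the
-- next profile.  Opaque so that the conversion checker compares iterates of transfer by their
-- arguments instead of unfolding them into sums over local packings.
opaque
  transfer : ∀ {h} → (Profile h → ℕ) → Profile h → ℕ
  transfer {h} v a = sumLocalPackings (localPlacements h) (whenBlank v) (full h) a

opaque
  unfolding transfer

  transfer-unfold : ∀ {h} (v : Profile h → ℕ) a →
                    transfer v a ≡ sumLocalPackings (localPlacements h) (whenBlank v) (full h) a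
  transfer-unfold v a = refl

-- profileCount m a counts the tilings of the first m columns together with the cells of profile a
-- in column m.
profileCount : ∀ {h} → ℕ → Profile h → ℕ
profileCount zero    a = when (does (blank? a)) 1
profileCount (suc m) a = transfer (profileCount m) a

-- Counting column by column

Fits-shift : ∀ {h w} r c k (D D′ : Demand) → (∀ i j → D′ i (suc j) ≡ D i j) →
             Cover.Fits h (suc w) (r , suc c , k) D′ ⇔ Cover.Fits h w (r , c , k) D
Fits-shift r c k D D′ D′≡D = mk⇔
  (λ fits i j cov → subst (1 ≤_) (D′≡D (toℕ i) (toℕ j)) (fits i (Fin.suc j) cov))
  from
  where
  from : Cover.Fits _ _ (r , c , k) D → Cover.Fits _ _ (r , suc c , k) D′
  from fits i Fin.zero    cov with () ← subst T (covers-leftOf r c k (toℕ i)) cov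
  from fits i (Fin.suc j) cov = subst (1 ≤_) (sym (D′≡D (toℕ i) (toℕ j))) (fits i j cov)

Fits-window : ∀ {h w} q (a b : Profile h) →
              Cover.Fits h (suc (suc w)) (atColumn 0 q) (frontier 0 a b) ⇔ LocalFits q a b
Fits-window (r , k) a b = mk⇔
  (λ fits i → fits i Fin.zero , fits i (Fin.suc Fin.zero))
  (λ { fits i Fin.zero                 → proj₁ (fits i)
     ; fits i (Fin.suc Fin.zero)       → proj₂ (fits i)
     ; fits i (Fin.suc (Fin.suc j)) cov →
         ⊥-elim (subst T (covers-beyond r 0 k (toℕ i) (suc (suc (toℕ j))) (s≤s (s≤s z≤n))) cov) })

fits-atColumn : ∀ {h} m {w} → suc (suc m) ≤ w → ∀ q (a b : Profile h) →
                Cover.Fits h w (atColumn m q) (frontier m a b) ⇔ LocalFits q a b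
fits-atColumn zero    {suc (suc w)} _         q a b = Fits-window q a b
fits-atColumn zero    {suc zero}    (s≤s ())
fits-atColumn (suc m) {suc w}       (s≤s m<w) q a b =
  fits-atColumn m m<w q a b
    ⇔-∘ Fits-shift (proj₁ q) m (proj₂ q) (frontier m a b) (frontier (suc m) a b) (λ _ _ → refl)

frontier-without : ∀ {h} m q (a b : Profile h) i j →
  (frontier m a b without atColumn m q) i j ≡ frontier m (leftAfter q a) (rightAfter q b) i j
frontier-without zero    q       a b i zero          = sym (bitAt-clear a _ i)
frontier-without zero    q       a b i (suc zero)    = sym (bitAt-clear b _ i)
frontier-without zero    q       a b i (suc (suc j)) = 0∸n≡0 (bit (covers (atColumn 0 q) i (suc (suc j))))
frontier-without (suc m) (r , k) a b i zero          = cong (λ c → 1 ∸ bit c) (covers-leftOf r m k i)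
frontier-without (suc m) q       a b i (suc j)       = frontier-without m q a b i j

byColumn-beyond : ∀ h m i j → m < j → All (λ p → covers p i j ≡ false) (byColumn h m)
byColumn-beyond h zero    i j _   = []
byColumn-beyond h (suc m) i j m<j =
  All.++⁺ (All.map⁺ (All.universal (λ (r , k) → covers-beyond r m k i j m<j) (localPlacements h)))
          (byColumn-beyond h m i j (≤-trans (n≤1+n (suc m)) m<j))

module _ (h w : ℕ) where
  open Cover h w

  sumPackings-atColumn : ∀ m → suc (suc m) ≤ w → ∀ qs {K} (K′ : Profile h → Profile h → ℕ) →
                         K Preserves _≈_ ⟶ _≡_ → (∀ a b → K (frontier m a b) ≡ K′ a b) →
                         ∀ a b → sumPackings (map (atColumn m) qs) K (frontier m a b) ≡ sumLocalPackings qs K′ a b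
  sumPackings-atColumn m m<w []       K′ K-cong K≡K′ a b = K≡K′ a b
  sumPackings-atColumn m m<w (q ∷ qs) K′ K-cong K≡K′ a b =
    cong₂ _+_ (sumPackings-atColumn m m<w qs K′ K-cong K≡K′ a b)
              (cong₂ when (does-⇔ (fits-atColumn m m<w q a b) (fits? (atColumn m q) (frontier m a b)) (localFits? q a b))
                          (trans (sumPackings-cong (map (atColumn m) qs) K-cong
                                                   (agree λ i j → frontier-without m q a b (toℕ i) (toℕ j)))
                                 (sumPackings-atColumn m m<w qs K′ K-cong K≡K′ (leftAfter q a) (rightAfter q b))))

  vanishes⇔blank : 0 < w → ∀ (a b : Profile h) → Blank b → Vanishes (frontier 0 a b) ⇔ Blank a
  vanishes⇔blank 0<w a b b-blank = mk⇔
    (λ vanish i → trans (cong (frontier 0 a b (toℕ i)) (sym (toℕ-fromℕ< 0<w))) (vanish i (Fin.fromℕ< 0<w)))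
    (λ a-blank i j → cell a-blank i (toℕ j))
    where
    cell : Blank a → ∀ i j → frontier 0 a b (toℕ i) j ≡ 0
    cell a-blank i zero          = a-blank i
    cell a-blank i (suc zero)    = b-blank i
    cell a-blank i (suc (suc j)) = refl

  exactCovers-byColumn : ∀ m → m < w → ∀ a b → Blank b →
                         exactCovers (byColumn h m) (frontier m a b) ≡ profileCount m a
  exactCovers-byColumn zero    0<w a b b-blank =
    cong (λ β → when β 1) (does-⇔ (vanishes⇔blank 0<w a b b-blank) (vanishes? (frontier 0 a b)) (blank? a))
  exactCovers-byColumn (suc m) m<w a b b-blank = begin
    exactCovers (byColumn h (suc m)) (frontier (suc m) a b)
      ≡⟨ exactCovers-cong (byColumn h (suc m)) (agree λ i j → frontier-shift m a b b-blank i (toℕ j)) ⟩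
    exactCovers (map (atColumn m) (localPlacements h) ++ byColumn h m) (frontier m (full h) a)
      ≡⟨ sumPackings-++ (map (atColumn m) (localPlacements h)) (byColumn h m) fulfilled (frontier m (full h) a) ⟩
    sumPackings (map (atColumn m) (localPlacements h)) (exactCovers (byColumn h m)) (frontier m (full h) a)
      ≡⟨ sumPackings-atColumn m m<w (localPlacements h) (whenBlank (profileCount m))
                              (exactCovers-cong (byColumn h m)) remaining (full h) a ⟩
    sumLocalPackings (localPlacements h) (whenBlank (profileCount m)) (full h) a
      ≡⟨ transfer-unfold (profileCount m) a ⟨
    profileCount (suc m) a ∎
    where
    open ≡-Reasoning
    remaining : ∀ a′ b′ → exactCovers (byColumn h m) (frontier m a′ b′) ≡ whenBlank (profileCount m) a′ b′
    remaining a′ b′ = remainingFor (blank? b′)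
      where
      remainingFor : (b′-blank? : Dec (Blank b′)) →
                     exactCovers (byColumn h m) (frontier m a′ b′) ≡ when (does b′-blank?) (profileCount m a′)
      remainingFor (yes b′-blank) = exactCovers-byColumn m (≤-trans (n≤1+n (suc m)) m<w) a′ b′ b′-blank
      remainingFor (no  b′-used)  with i , b′ᵢ≢0 ← ¬∀⟶∃¬ h _ (λ i → bitAt b′ (toℕ i) ≟ 0) b′-used =
        exactCovers-uncovered (byColumn h m) (frontier m a′ b′) i j
          (subst (1 ≤_) (sym (trans (cong (frontier m a′ b′ (toℕ i)) (toℕ-fromℕ< m<w))
                                    (frontier-right m a′ b′ (toℕ i))))
                 (n≢0⇒n>0 b′ᵢ≢0))
          (subst (λ c → All (λ p → covers p (toℕ i) c ≡ false) (byColumn h m)) (sym (toℕ-fromℕ< m<w))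
                 (byColumn-beyond h m (toℕ i) (suc m) ≤-refl))
        where
        j : Fin w
        j = Fin.fromℕ< m<w

tilings≡profileCount : ∀ m → tilings (suc m) ≡ profileCount m (full 5)
tilings≡profileCount m = begin
  tilings (suc m)
    ≡⟨ tilings≡exactCovers m ⟩
  Cover.exactCovers 5 (suc m) (byColumn 5 m) (λ _ _ → 1)
    ≡⟨ Cover.exactCovers-cong 5 (suc m) (byColumn 5 m) all-ones ⟩
  Cover.exactCovers 5 (suc m) (byColumn 5 m) (frontier m (full 5) (blank 5))
    ≡⟨ exactCovers-byColumn 5 (suc m) m ≤-refl (full 5) (blank 5) blank-Blank ⟩
  profileCount m (full 5) ∎
  where
  open ≡-Reasoning
  all-ones : Cover._≈_ 5 (suc m) (λ _ _ → 1) (frontier m (full 5) (blank 5))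
  all-ones = Cover.agree λ i j → sym (frontier-full m (blank 5) i (toℕ j) (toℕ≤pred[n] j))

-- Linearity and linear recurrences

module _ {h : ℕ} where

  sumLocalPackings-cong : ∀ qs {K K′ : Profile h → Profile h → ℕ} → (∀ a b → K a b ≡ K′ a b) →
                          ∀ a b → sumLocalPackings qs K a b ≡ sumLocalPackings qs K′ a b
  sumLocalPackings-cong []       K≡K′ a b = K≡K′ a b
  sumLocalPackings-cong (q ∷ qs) K≡K′ a b =
    cong₂ _+_ (sumLocalPackings-cong qs K≡K′ a b) (cong (when _) (sumLocalPackings-cong qs K≡K′ _ _))

  sumLocalPackings-affine : ∀ qs c (K₁ K₂ : Profile h → Profile h → ℕ) a b →
    sumLocalPackings qs (λ a b → c * K₁ a b + K₂ a b) a b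
      ≡ c * sumLocalPackings qs K₁ a b + sumLocalPackings qs K₂ a b
  sumLocalPackings-affine []       c K₁ K₂ a b = refl
  sumLocalPackings-affine (q ∷ qs) c K₁ K₂ a b = begin
      S a b + when β (S a′ b′)
    ≡⟨ cong₂ (λ x y → x + when β y) (sumLocalPackings-affine qs c K₁ K₂ a b)
                                     (sumLocalPackings-affine qs c K₁ K₂ a′ b′) ⟩
      (c * S₁ a b + S₂ a b) + when β (c * S₁ a′ b′ + S₂ a′ b′)
    ≡⟨ cong ((c * S₁ a b + S₂ a b) +_) (when-affine β c (S₁ a′ b′) (S₂ a′ b′)) ⟩
      (c * S₁ a b + S₂ a b) + (c * when β (S₁ a′ b′) + when β (S₂ a′ b′))
    ≡⟨ exchange (c * S₁ a b) (S₂ a b) (c * when β (S₁ a′ b′)) (when β (S₂ a′ b′)) ⟩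
      (c * S₁ a b + c * when β (S₁ a′ b′)) + (S₂ a b + when β (S₂ a′ b′))
    ≡⟨ cong (_+ (S₂ a b + when β (S₂ a′ b′))) (*-distribˡ-+ c (S₁ a b) _) ⟨
      c * (S₁ a b + when β (S₁ a′ b′)) + (S₂ a b + when β (S₂ a′ b′))
    ∎
    where
    open ≡-Reasoning
    S S₁ S₂ : Profile h → Profile h → ℕ
    S  = sumLocalPackings qs (λ a b → c * K₁ a b + K₂ a b)
    S₁ = sumLocalPackings qs K₁
    S₂ = sumLocalPackings qs K₂
    β  = does (localFits? q a b)
    a′ = leftAfter q a
    b′ = rightAfter q b
    exchange : ∀ w x y z → (w + x) + (y + z) ≡ (w + y) + (x + z)
    exchange = solve-∀

  sumLocalPackings-zero : ∀ qs (a b : Profile h) → sumLocalPackings qs (λ _ _ → 0) a b ≡ 0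
  sumLocalPackings-zero []       a b = refl
  sumLocalPackings-zero (q ∷ qs) a b =
    trans (cong₂ (λ x y → x + when β y) (sumLocalPackings-zero qs a b) (sumLocalPackings-zero qs _ _))
          (when-zero β)
    where
    β = does (localFits? q a b)

  transfer-cong : ∀ {f g : Profile h → ℕ} → f ≗ g → transfer f ≗ transfer g
  transfer-cong {f} {g} f≗g a = begin
    transfer f a                                              ≡⟨ transfer-unfold f a ⟩
    sumLocalPackings (localPlacements h) (whenBlank f) (full h) a
      ≡⟨ sumLocalPackings-cong (localPlacements h) (λ a′ b′ → cong (when _) (f≗g a′)) (full h) a ⟩
    sumLocalPackings (localPlacements h) (whenBlank g) (full h) a ≡⟨ transfer-unfold g a ⟨
    transfer g a                                              ∎
    where open ≡-Reasoning

  transfer-affine : ∀ c (f g : Profile h → ℕ) →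
                    transfer (λ a → c * f a + g a) ≗ λ a → c * transfer f a + transfer g a
  transfer-affine c f g a = begin
    transfer (λ a → c * f a + g a) a
      ≡⟨ transfer-unfold _ a ⟩
    sumLocalPackings qs (whenBlank (λ a → c * f a + g a)) (full h) a
      ≡⟨ sumLocalPackings-cong qs (λ a′ b′ → when-affine (does (blank? b′)) c (f a′) (g a′)) (full h) a ⟩
    sumLocalPackings qs (λ a′ b′ → c * whenBlank f a′ b′ + whenBlank g a′ b′) (full h) a
      ≡⟨ sumLocalPackings-affine qs c (whenBlank f) (whenBlank g) (full h) a ⟩
    c * sumLocalPackings qs (whenBlank f) (full h) a + sumLocalPackings qs (whenBlank g) (full h) a
      ≡⟨ cong₂ (λ x y → c * x + y) (transfer-unfold f a) (transfer-unfold g a) ⟨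
    c * transfer f a + transfer g a ∎
    where
    open ≡-Reasoning
    qs = localPlacements h

  transfer-zero : transfer (λ _ → 0) ≗ λ _ → 0
  transfer-zero a =
    trans (transfer-unfold _ a)
          (trans (sumLocalPackings-cong (localPlacements h) (λ a′ b′ → when-zero (does (blank? b′))) (full h) a)
                 (sumLocalPackings-zero (localPlacements h) (full h) a))

module LinearRecurrence {A : Set} (L : (A → ℕ) → A → ℕ)
  (L-cong   : ∀ {f g} → f ≗ g → L f ≗ L g)
  (L-affine : ∀ c f g → L (λ a → c * f a + g a) ≗ λ a → c * L f a + L g a)
  (L-zero   : L (λ _ → 0) ≗ λ _ → 0) where

  lincomb : List (ℕ × ℕ) → (ℕ → A → ℕ) → A → ℕ
  lincomb []             x a = 0
  lincomb ((c , i) ∷ cs) x a = c * x i a + lincomb cs x a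

  lincomb-cong : ∀ cs {x y : ℕ → A → ℕ} → All (λ (c , i) → x i ≗ y i) cs → lincomb cs x ≗ lincomb cs y
  lincomb-cong []             []            a = refl
  lincomb-cong ((c , i) ∷ cs) (xᵢ≗yᵢ ∷ x≗y) a =
    cong₂ (λ u v → c * u + v) (xᵢ≗yᵢ a) (lincomb-cong cs x≗y a)

  L-lincomb : ∀ cs x → L (lincomb cs x) ≗ lincomb cs (λ i → L (x i))
  L-lincomb []             x   = L-zero
  L-lincomb ((c , i) ∷ cs) x a =
    trans (L-affine c (x i) (lincomb cs x) a) (cong (c * L (x i) a +_) (L-lincomb cs x a))

  recurrence-propagates : ∀ (x : ℕ → A → ℕ) → (∀ n → x (suc n) ≗ L (x n)) →
                          ∀ d cs → x d ≗ lincomb cs x → ∀ n → x (n + d) ≗ lincomb cs (λ i → x (n + i))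
  recurrence-propagates x step d cs base zero      = base
  recurrence-propagates x step d cs base (suc n) a = begin
    x (suc n + d) a                    ≡⟨ step (n + d) a ⟩
    L (x (n + d)) a                    ≡⟨ L-cong (recurrence-propagates x step d cs base n) a ⟩
    L (lincomb cs (λ i → x (n + i))) a ≡⟨ L-lincomb cs (λ i → x (n + i)) a ⟩
    lincomb cs (λ i → L (x (n + i))) a ≡⟨ lincomb-cong cs (All.universal (λ (c , i) b → sym (step (n + i) b)) cs) a ⟩
    lincomb cs (λ i → x (suc n + i)) a ∎
    where open ≡-Reasoning

-- The first fifteen iterates for height 5

index : ∀ {h} → Profile h → ℕ
index []      = 0
index (x ∷ a) = bit x + 2 * index a

lookupOr0 : List ℕ → ℕ → ℕ
lookupOr0 []       _       = 0
lookupOr0 (x ∷ xs) zero    = x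
lookupOr0 (x ∷ xs) (suc i) = lookupOr0 xs i

⟦_⟧ : List ℕ → Profile 5 → ℕ
⟦ t ⟧ a = lookupOr0 t (index a)

allProfiles? : ∀ {h} {P : Profile h → Set} → Decidable P → Dec (∀ a → P a)
allProfiles? {zero}  P? = map′ (λ p → λ { [] → p }) (λ p → p []) (P? [])
allProfiles? {suc h} P? =
  map′ (λ (p , q) → λ { (true ∷ a) → p a ; (false ∷ a) → q a })
       (λ p → (λ a → p (true ∷ a)) , (λ a → p (false ∷ a)))
       (allProfiles? (λ a → P? (true ∷ a)) ×-dec allProfiles? (λ a → P? (false ∷ a)))

-- table k lists profileCount k on the 32 profiles of height 5, in the order of index.  Evaluating
-- profileCount k directly takes time exponential in k; the tables are checked one transfer step
-- at a time instead.
table : ℕ → List ℕ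
table 0 = 1 ∷ 0 ∷ 0 ∷ 0 ∷ 0 ∷ 0 ∷ 0 ∷ 0 ∷ 0 ∷ 0 ∷ 0 ∷ 0 ∷ 0 ∷ 0 ∷ 0 ∷ 0 ∷ 0 ∷ 0 ∷ 0 ∷ 0 ∷ 0 ∷ 0 ∷ 0 ∷ 0 ∷ 0 ∷ 0 ∷ 0 ∷ 0 ∷ 0 ∷ 0 ∷ 0 ∷ 0 ∷ []
table 1 = 0 ∷ 0 ∷ 0 ∷ 0 ∷ 0 ∷ 0 ∷ 0 ∷ 0 ∷ 0 ∷ 0 ∷ 0 ∷ 0 ∷ 0 ∷ 0 ∷ 0 ∷ 2 ∷ 0 ∷ 0 ∷ 0 ∷ 0 ∷ 0 ∷ 0 ∷ 0 ∷ 2 ∷ 0 ∷ 0 ∷ 0 ∷ 0 ∷ 0 ∷ 2 ∷ 2 ∷ 0 ∷ []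
table 2 = 0 ∷ 0 ∷ 0 ∷ 4 ∷ 0 ∷ 0 ∷ 2 ∷ 0 ∷ 0 ∷ 0 ∷ 0 ∷ 0 ∷ 2 ∷ 0 ∷ 0 ∷ 0 ∷ 0 ∷ 0 ∷ 0 ∷ 0 ∷ 0 ∷ 0 ∷ 0 ∷ 0 ∷ 4 ∷ 0 ∷ 0 ∷ 0 ∷ 0 ∷ 0 ∷ 0 ∷ 0 ∷ []
table 3 = 0 ∷ 0 ∷ 0 ∷ 0 ∷ 0 ∷ 0 ∷ 0 ∷ 8 ∷ 0 ∷ 0 ∷ 0 ∷ 2 ∷ 0 ∷ 4 ∷ 8 ∷ 0 ∷ 0 ∷ 0 ∷ 0 ∷ 2 ∷ 0 ∷ 0 ∷ 4 ∷ 0 ∷ 0 ∷ 2 ∷ 2 ∷ 0 ∷ 8 ∷ 0 ∷ 0 ∷ 0 ∷ []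
table 4 = 0 ∷ 8 ∷ 10 ∷ 0 ∷ 4 ∷ 0 ∷ 0 ∷ 0 ∷ 10 ∷ 0 ∷ 0 ∷ 0 ∷ 0 ∷ 0 ∷ 0 ∷ 8 ∷ 8 ∷ 0 ∷ 0 ∷ 0 ∷ 0 ∷ 0 ∷ 0 ∷ 0 ∷ 0 ∷ 0 ∷ 0 ∷ 16 ∷ 0 ∷ 0 ∷ 8 ∷ 0 ∷ []
table 5 = 0 ∷ 0 ∷ 0 ∷ 8 ∷ 0 ∷ 8 ∷ 24 ∷ 0 ∷ 0 ∷ 12 ∷ 20 ∷ 0 ∷ 24 ∷ 0 ∷ 0 ∷ 0 ∷ 0 ∷ 4 ∷ 12 ∷ 0 ∷ 8 ∷ 0 ∷ 0 ∷ 0 ∷ 8 ∷ 0 ∷ 0 ∷ 0 ∷ 0 ∷ 0 ∷ 0 ∷ 72 ∷ []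
table 6 = 72 ∷ 0 ∷ 0 ∷ 0 ∷ 0 ∷ 0 ∷ 0 ∷ 32 ∷ 0 ∷ 0 ∷ 0 ∷ 48 ∷ 0 ∷ 16 ∷ 40 ∷ 0 ∷ 0 ∷ 0 ∷ 0 ∷ 32 ∷ 0 ∷ 0 ∷ 16 ∷ 0 ∷ 0 ∷ 32 ∷ 48 ∷ 0 ∷ 32 ∷ 0 ∷ 0 ∷ 0 ∷ []
table 7 = 0 ∷ 32 ∷ 64 ∷ 0 ∷ 64 ∷ 0 ∷ 0 ∷ 0 ∷ 64 ∷ 0 ∷ 0 ∷ 0 ∷ 0 ∷ 0 ∷ 0 ∷ 240 ∷ 32 ∷ 0 ∷ 0 ∷ 0 ∷ 0 ∷ 0 ∷ 0 ∷ 144 ∷ 0 ∷ 0 ∷ 0 ∷ 72 ∷ 0 ∷ 144 ∷ 240 ∷ 0 ∷ []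
table 8 = 0 ∷ 0 ∷ 0 ∷ 384 ∷ 0 ∷ 32 ∷ 248 ∷ 0 ∷ 0 ∷ 96 ∷ 128 ∷ 0 ∷ 248 ∷ 0 ∷ 0 ∷ 0 ∷ 0 ∷ 64 ∷ 96 ∷ 0 ∷ 32 ∷ 0 ∷ 0 ∷ 0 ∷ 384 ∷ 0 ∷ 0 ∷ 0 ∷ 0 ∷ 0 ∷ 0 ∷ 384 ∷ []
table 9 = 384 ∷ 0 ∷ 0 ∷ 0 ∷ 0 ∷ 0 ∷ 0 ∷ 928 ∷ 0 ∷ 0 ∷ 0 ∷ 440 ∷ 0 ∷ 416 ∷ 960 ∷ 0 ∷ 0 ∷ 0 ∷ 0 ∷ 280 ∷ 0 ∷ 0 ∷ 416 ∷ 0 ∷ 0 ∷ 280 ∷ 440 ∷ 0 ∷ 928 ∷ 0 ∷ 0 ∷ 0 ∷ []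
table 10 = 0 ∷ 928 ∷ 1208 ∷ 0 ∷ 560 ∷ 0 ∷ 0 ∷ 0 ∷ 1208 ∷ 0 ∷ 0 ∷ 0 ∷ 0 ∷ 0 ∷ 0 ∷ 1904 ∷ 928 ∷ 0 ∷ 0 ∷ 0 ∷ 0 ∷ 0 ∷ 0 ∷ 768 ∷ 0 ∷ 0 ∷ 0 ∷ 1792 ∷ 0 ∷ 768 ∷ 1904 ∷ 0 ∷ []
table 11 = 0 ∷ 0 ∷ 0 ∷ 2672 ∷ 0 ∷ 928 ∷ 3488 ∷ 0 ∷ 0 ∷ 1488 ∷ 2416 ∷ 0 ∷ 3488 ∷ 0 ∷ 0 ∷ 0 ∷ 0 ∷ 560 ∷ 1488 ∷ 0 ∷ 928 ∷ 0 ∷ 0 ∷ 0 ∷ 2672 ∷ 0 ∷ 0 ∷ 0 ∷ 0 ∷ 0 ∷ 0 ∷ 8544 ∷ []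
table 12 = 8544 ∷ 0 ∷ 0 ∷ 0 ∷ 0 ∷ 0 ∷ 0 ∷ 7392 ∷ 0 ∷ 0 ∷ 0 ∷ 6464 ∷ 0 ∷ 3600 ∷ 8320 ∷ 0 ∷ 0 ∷ 0 ∷ 0 ∷ 4416 ∷ 0 ∷ 0 ∷ 3600 ∷ 0 ∷ 0 ∷ 4416 ∷ 6464 ∷ 0 ∷ 7392 ∷ 0 ∷ 0 ∷ 0 ∷ []
table 13 = 0 ∷ 7392 ∷ 11808 ∷ 0 ∷ 8832 ∷ 0 ∷ 0 ∷ 0 ∷ 11808 ∷ 0 ∷ 0 ∷ 0 ∷ 0 ∷ 0 ∷ 0 ∷ 31568 ∷ 7392 ∷ 0 ∷ 0 ∷ 0 ∷ 0 ∷ 0 ∷ 0 ∷ 17088 ∷ 0 ∷ 0 ∷ 0 ∷ 15520 ∷ 0 ∷ 17088 ∷ 31568 ∷ 0 ∷ []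
table 14 = 0 ∷ 0 ∷ 0 ∷ 48656 ∷ 0 ∷ 7392 ∷ 40000 ∷ 0 ∷ 0 ∷ 16224 ∷ 23616 ∷ 0 ∷ 40000 ∷ 0 ∷ 0 ∷ 0 ∷ 0 ∷ 8832 ∷ 16224 ∷ 0 ∷ 7392 ∷ 0 ∷ 0 ∷ 0 ∷ 48656 ∷ 0 ∷ 0 ∷ 0 ∷ 0 ∷ 0 ∷ 0 ∷ 76800 ∷ []
table _ = []

profileCount-0-table : profileCount 0 ≗ ⟦ table 0 ⟧
profileCount-0-table = toWitness {a? = allProfiles? λ a → profileCount 0 a ≟ ⟦ table 0 ⟧ a} tt

opaque
  unfolding transfer

  transfer-table : All (λ k → transfer ⟦ table k ⟧ ≗ ⟦ table (suc k) ⟧) (upTo 14)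
  transfer-table =
    toWitness {a? = All.all? (λ k → allProfiles? λ a → transfer ⟦ table k ⟧ a ≟ ⟦ table (suc k) ⟧ a) (upTo 14)} tt

profileCount-table : ∀ k → k ≤ 14 → profileCount k ≗ ⟦ table k ⟧
profileCount-table zero    _    = profileCount-0-table
profileCount-table (suc k) k<14 a =
  trans (transfer-cong (profileCount-table k (<⇒≤ k<14)) a) (All.applyUpTo⁻ id 14 transfer-table k<14 a)

recurrenceTerms : List (ℕ × ℕ)
recurrenceTerms = (2 , 9) ∷ (103 , 6) ∷ (280 , 3) ∷ (380 , 0) ∷ []

open LinearRecurrence (transfer {5}) transfer-cong transfer-affine transfer-zero

table-recurrence : ⟦ table 14 ⟧ ≗ lincomb recurrenceTerms (λ i → ⟦ table (2 + i) ⟧)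
table-recurrence =
  toWitness {a? = allProfiles? λ a → ⟦ table 14 ⟧ a ≟ lincomb recurrenceTerms (λ i → ⟦ table (2 + i) ⟧) a} tt

profileCount-recurrence-base : profileCount 14 ≗ lincomb recurrenceTerms (λ i → profileCount (2 + i))
profileCount-recurrence-base a = begin
  profileCount 14 a                                      ≡⟨ profileCount-table 14 ≤-refl a ⟩
  ⟦ table 14 ⟧ a                                         ≡⟨ table-recurrence a ⟩
  lincomb recurrenceTerms (λ i → ⟦ table (2 + i) ⟧) a    ≡⟨ lincomb-cong recurrenceTerms viaTables a ⟨
  lincomb recurrenceTerms (λ i → profileCount (2 + i)) a ∎
  where
  open ≡-Reasoning
  viaTables : All (λ (c , i) → profileCount (2 + i) ≗ ⟦ table (2 + i) ⟧) recurrenceTerms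
  viaTables = profileCount-table 11 (m≤m+n 11 3) ∷ profileCount-table 8 (m≤m+n 8 6)
            ∷ profileCount-table 5 (m≤m+n 5 9) ∷ profileCount-table 2 (m≤m+n 2 12) ∷ []

profileCount-recurrence : ∀ n → profileCount (2 + (n + 12)) ≗ lincomb recurrenceTerms (λ i → profileCount (2 + (n + i)))
profileCount-recurrence =
  recurrence-propagates (λ n → profileCount (2 + n)) (λ n a → refl) 12 recurrenceTerms profileCount-recurrence-base

-- The generating function

N-suc : ∀ u → N (suc u) ≡ profileCount (2 + 3 * u) (full 5)
N-suc u = trans (cong tilings (columns u)) (tilings≡profileCount (2 + 3 * u))
  where
  columns : ∀ u → 3 * suc u ≡ suc (2 + 3 * u)
  columns = solve-∀

N-suc-+ : ∀ k s → N (suc (k + s)) ≡ profileCount (2 + (3 * s + 3 * k)) (full 5)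
N-suc-+ k s = trans (N-suc (k + s)) (cong (λ n → profileCount (2 + n) (full 5)) (distrib k s))
  where
  distrib : ∀ k s → 3 * (k + s) ≡ 3 * s + 3 * k
  distrib = solve-∀

N-recurrence : ∀ s → N (5 + s) ≡ 2 * N (4 + s) + (103 * N (3 + s) + (280 * N (2 + s) + (380 * N (1 + s) + 0)))
N-recurrence s = begin
  N (5 + s)                                ≡⟨ N-suc-+ 4 s ⟩
  profileCount (2 + (3 * s + 12)) (full 5) ≡⟨ profileCount-recurrence (3 * s) (full 5) ⟩
  lincomb recurrenceTerms (λ i → profileCount (2 + (3 * s + i))) (full 5)
    ≡⟨ cong₂ (λ x y → 2 * x + y) (N-suc-+ 3 s) (cong₂ (λ x y → 103 * x + y) (N-suc-+ 2 s)
         (cong₂ (λ x y → 280 * x + y) (N-suc-+ 1 s) (cong (λ x → 380 * x + 0) (N-suc-+ 0 s)))) ⟨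
  2 * N (4 + s) + (103 * N (3 + s) + (280 * N (2 + s) + (380 * N (1 + s) + 0))) ∎
  where open ≡-Reasoning

initialN : ℕ → ℕ
initialN = lookupOr0 (1 ∷ 0 ∷ 72 ∷ 384 ∷ 8544 ∷ [])

N-initial : ∀ k → k ≤ 4 → N k ≡ initialN k
N-initial zero    _         = refl
N-initial (suc u) (s≤s u≤3) = trans (N-suc u) (viaTable u u≤3)
  where
  viaTable : ∀ u → u ≤ 3 → profileCount (2 + 3 * u) (full 5) ≡ initialN (suc u)
  viaTable 0 _ = profileCount-table 2 (m≤m+n 2 12) (full 5)
  viaTable 1 _ = profileCount-table 5 (m≤m+n 5 9) (full 5)
  viaTable 2 _ = profileCount-table 8 (m≤m+n 8 6) (full 5)
  viaTable 3 _ = profileCount-table 11 (m≤m+n 11 3) (full 5)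
  viaTable (suc (suc (suc (suc u)))) (s≤s (s≤s (s≤s ())))

module _ where
  open import Data.Integer using (ℤ; +_; -[1+_]) renaming (_+_ to _+ℤ_; _*_ to _*ℤ_)

  dot : List ℤ → (ℕ → ℤ) → ℤ
  dot []       g = + 0
  dot (c ∷ cs) g = c *ℤ g 0 +ℤ dot cs (g ∘ suc)

  ⋆-poly-[] : ∀ f n → (poly [] ⋆ f) n ≡ + 0
  ⋆-poly-[] f n = sum-zeros (upTo (suc n))
    where
    sum-zeros : ∀ ks → foldr _+ℤ_ (+ 0) (map (λ k → + 0 *ℤ f (n ∸ k)) ks) ≡ + 0
    sum-zeros []       = refl
    sum-zeros (k ∷ ks) = cong (+ 0 +ℤ_) (sum-zeros ks)

  ⋆-poly-∷ : ∀ c cs f n → (poly (c ∷ cs) ⋆ f) (suc n) ≡ c *ℤ f (suc n) +ℤ (poly cs ⋆ f) n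
  ⋆-poly-∷ c cs f n = cong (c *ℤ f (suc n) +ℤ_)
    (trans (cong (foldr _+ℤ_ (+ 0)) (map-applyUpTo suc (λ k → poly (c ∷ cs) k *ℤ f (suc n ∸ k)) (suc n)))
           (sym (cong (foldr _+ℤ_ (+ 0)) (map-applyUpTo id (λ k → poly cs k *ℤ f (n ∸ k)) (suc n)))))

  ⋆-poly : ∀ cs f s → (poly cs ⋆ f) (length cs + s) ≡ dot cs (λ i → f (length cs + s ∸ i))
  ⋆-poly []       f s = ⋆-poly-[] f s
  ⋆-poly (c ∷ cs) f s =
    trans (⋆-poly-∷ c cs f (length cs + s)) (cong (c *ℤ f (suc (length cs + s)) +ℤ_) (⋆-poly cs f s))

  ⋆-congʳ : ∀ d f g n → (∀ k → f (n ∸ k) ≡ g (n ∸ k)) → (d ⋆ f) n ≡ (d ⋆ g) n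
  ⋆-congʳ d f g n f≡g = cong (foldr _+ℤ_ (+ 0)) (map-cong (λ k → cong (d k *ℤ_) (f≡g k)) (upTo (suc n)))

  -- The series F is kept abstract, with its values related to f only propositionally: a goal in
  -- which N occurs under integer arithmetic would make the conversion checker evaluate tilings.
  denominator-annihilates : ∀ (F : Series) (f : ℕ → ℕ) → (∀ k → F k ≡ + f k) → ∀ s →
    f (5 + s) ≡ 2 * f (4 + s) + (103 * f (3 + s) + (280 * f (2 + s) + (380 * f (1 + s) + 0))) →
    (denominator ⋆ F) (5 + s) ≡ + 0
  denominator-annihilates F f F≡f s rec = begin
    (denominator ⋆ F) (5 + s)
      ≡⟨ ⋆-congʳ denominator F (λ k → + f k) (5 + s) (λ k → F≡f (5 + s ∸ k)) ⟩
    (denominator ⋆ (λ k → + f k)) (5 + s)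
      ≡⟨ ⋆-poly (+ 1 ∷ -[1+ 1 ] ∷ -[1+ 102 ] ∷ -[1+ 279 ] ∷ -[1+ 379 ] ∷ []) (λ k → + f k) s ⟩
    + 1 *ℤ + A +ℤ rest
      ≡⟨ cong (λ x → + 1 *ℤ x +ℤ rest) (trans (cong +_ rec) (ℕ-to-ℤ B C D E)) ⟩
    + 1 *ℤ (+ 2 *ℤ + B +ℤ (+ 103 *ℤ + C +ℤ (+ 280 *ℤ + D +ℤ (+ 380 *ℤ + E +ℤ + 0)))) +ℤ rest
      ≡⟨ cancel (+ B) (+ C) (+ D) (+ E) ⟩
    + 0 ∎
    where
    open ≡-Reasoning
    A B C D E : ℕ
    A = f (5 + s)
    B = f (4 + s)
    C = f (3 + s)
    D = f (2 + s)
    E = f (1 + s)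
    rest : ℤ
    rest = -[1+ 1 ] *ℤ + B +ℤ (-[1+ 102 ] *ℤ + C +ℤ (-[1+ 279 ] *ℤ + D +ℤ (-[1+ 379 ] *ℤ + E +ℤ + 0)))
    ℕ-to-ℤ : ∀ B C D E → + (2 * B + (103 * C + (280 * D + (380 * E + 0))))
                         ≡ + 2 *ℤ + B +ℤ (+ 103 *ℤ + C +ℤ (+ 280 *ℤ + D +ℤ (+ 380 *ℤ + E +ℤ + 0)))
    ℕ-to-ℤ B C D E =
      trans (pos-+ (2 * B) _)   (cong₂ _+ℤ_ (pos-* 2 B)
      (trans (pos-+ (103 * C) _) (cong₂ _+ℤ_ (pos-* 103 C)
      (trans (pos-+ (280 * D) _) (cong₂ _+ℤ_ (pos-* 280 D)
      (trans (pos-+ (380 * E) 0) (cong₂ _+ℤ_ (pos-* 380 E) refl)))))))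
    cancel : ∀ (B C D E : ℤ) →
      + 1 *ℤ (+ 2 *ℤ B +ℤ (+ 103 *ℤ C +ℤ (+ 280 *ℤ D +ℤ (+ 380 *ℤ E +ℤ + 0))))
        +ℤ (-[1+ 1 ] *ℤ B +ℤ (-[1+ 102 ] *ℤ C +ℤ (-[1+ 279 ] *ℤ D +ℤ (-[1+ 379 ] *ℤ E +ℤ + 0)))) ≡ + 0
    cancel = ℤ-solve-∀

  initial-coefficients : ∀ t → t ≤ 4 → (denominator ⋆ NSeries) t ≡ numerator t
  initial-coefficients t t≤4 =
    trans (⋆-congʳ denominator NSeries (λ k → + initialN k) t
                   (λ k → cong +_ (N-initial (t ∸ k) (≤-trans (m∸n≤m t k) t≤4))))
          (by-computation t t≤4)
    where
    by-computation : ∀ t → t ≤ 4 → (denominator ⋆ (λ k → + initialN k)) t ≡ numerator t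
    by-computation 0 _ = refl
    by-computation 1 _ = refl
    by-computation 2 _ = refl
    by-computation 3 _ = refl
    by-computation 4 _ = refl
    by-computation (suc (suc (suc (suc (suc t))))) (s≤s (s≤s (s≤s (s≤s ()))))

  -- No with-abstraction here or in mainTheorem3: abstracting over a goal normalises it, and these
  -- goals contain N.
  later-coefficients : ∀ t → 4 < t → (denominator ⋆ NSeries) t ≡ numerator t
  later-coefficients t 4<t =
    let s , 5+s≡t = m≤n⇒∃[o]m+o≡n 4<t in
    subst (λ t → (denominator ⋆ NSeries) t ≡ numerator t) 5+s≡t
          (denominator-annihilates NSeries N (λ _ → refl) s (N-recurrence s))

mainTheorem3 : ∀ t → (denominator ⋆ NSeries) t ≡ numerator t
mainTheorem3 t = [ initial-coefficients t , later-coefficients t ]′ (≤-<-connex t 4)
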